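{- (i) If $(\alpha,\beta,\gamma)\in R$ then $\alpha,\beta,\gamma>0$. (ii) If $(\alpha,\beta,\gamma)\in R_2$ then $0<\alpha,\beta,\gamma<1$.
   Context: $R=\{(\alpha,\beta,\gamma)\in[0,1]^3:\alpha\beta+\gamma>1,\ \alpha\gamma+\beta>1,\ \beta\gamma+\alpha>1\}$, $\Delta(\alpha,\beta,\gamma)=\alpha^2+\beta^2+\gamma^2-2\alpha\beta-2\alpha\gamma-2\beta\gamma+4\alpha\beta\gamma$, and $R_2=\{(\alpha,\beta,\gamma)\in R:\Delta(\alpha,\beta,\gamma)<0\}$. -}

module Defs where

open import Level using (Level; _⊔_; suc)
open import Data.Sum using (_⊎_)
open import Data.Product using (_×_; Σ)
open import Relation.Nullary using (¬_)
open import Relation.Binary.Core using (Rel)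
open import Relation.Binary.Structures using (IsStrictTotalOrder)
open import Algebra.Structures using (IsCommutativeRing)

-- The statement is purely
-- first-order in the language of ordered fields, so we state it for an
-- arbitrary ordered field (the standard axioms); ℝ is one instance.
record OrderedField c ℓ₁ ℓ₂ : Set (suc (c ⊔ ℓ₁ ⊔ ℓ₂)) where
  infix  4 _≈_ _<_
  infixl 7 _*_
  infixl 6 _+_
  infix  8 -_
  field
    Carrier : Set c
    _≈_     : Rel Carrier ℓ₁
    _<_     : Rel Carrier ℓ₂
    _+_     : Carrier → Carrier → Carrier
    _*_     : Carrier → Carrier → Carrier
    -_      : Carrier → Carrier
    0#      : Carrier
    1#      : Carrier
    isCommutativeRing : IsCommutativeRing _≈_ _+_ _*_ -_ 0# 1#
    isStrictTotalOrder : IsStrictTotalOrder _≈_ _<_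
    0≉1     : ¬ (0# ≈ 1#)
    inverse : ∀ x → ¬ (x ≈ 0#) → Σ Carrier (λ y → x * y ≈ 1#)
    +-mono-< : ∀ {x y} z → x < y → x + z < y + z
    *-pos    : ∀ {x y} → 0# < x → 0# < y → 0# < x * y

  infix 4 _≤_
  _≤_ : Carrier → Carrier → Set (ℓ₁ ⊔ ℓ₂)
  x ≤ y = x < y ⊎ x ≈ y

  2# 4# : Carrier
  2# = 1# + 1#
  4# = 2# + 2#

  _-_ : Carrier → Carrier → Carrier
  x - y = x + - y
  infixl 6 _-_

  InUnit : Carrier → Set (ℓ₁ ⊔ ℓ₂)
  InUnit x = 0# ≤ x × x ≤ 1#

  InR : Carrier → Carrier → Carrier → Set (ℓ₁ ⊔ ℓ₂)
  InR α β γ = (InUnit α × InUnit β × InUnit γ)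
            × (1# < α * β + γ) × (1# < α * γ + β) × (1# < β * γ + α)

  Δ : Carrier → Carrier → Carrier → Carrier
  Δ α β γ = α * α + β * β + γ * γ
            - 2# * α * β - 2# * α * γ - 2# * β * γ
            + 4# * α * β * γ

  InR₂ : Carrier → Carrier → Carrier → Set (ℓ₁ ⊔ ℓ₂)
  InR₂ α β γ = InR α β γ × Δ α β γ < 0#

-- Part (i): if α = 0 then αβ + γ = γ ≤ 1, contradicting αβ + γ > 1; likewise for β and γ.
-- Part (ii): Δ(α,β,γ) = (β + γ − α)² + 4βγ(α − 1), so α = 1 would make Δ a square,
-- contradicting Δ < 0; β and γ follow since Δ is symmetric.
module Submission where

open import Defs
open import Algebra.Bundles using (CommutativeRing; RawRing)
open import Algebra.Solver.Ring.AlmostCommutativeRing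
  using (fromCommutativeRing; _-Raw-AlmostCommutative⟶_)
open import Data.Empty using (⊥-elim)
open import Data.Integer.Base as ℤ using (ℤ; +_; -[1+_])
import Data.Integer.Properties as ℤ
open import Data.Maybe.Base using (Maybe; just; nothing)
open import Data.Nat.Base as ℕ using (zero; suc)
import Data.Nat.Properties as ℕ
open import Data.Product using (_×_; _,_)
open import Data.Sum using (inj₁; inj₂)
open import Relation.Binary.Definitions using (tri<; tri≈; tri>)
open import Relation.Binary.PropositionalEquality as ≡ using (_≡_)
open import Relation.Binary.Structures using (IsStrictTotalOrder)
open import Relation.Nullary using (¬_; yes; no)

module IntegerCoefficients {r₁ r₂} (R : CommutativeRing r₁ r₂) where

  open CommutativeRing R
  open import Algebra.Properties.AbelianGroup +-abelianGroup using (⁻¹-∙-comm)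
  open import Algebra.Properties.Group +-group using (ε⁻¹≈ε; ⁻¹-involutive; //-rightDividesʳ)
  open import Algebra.Properties.Ring ring using (-‿distribˡ-*; -‿distribʳ-*)
  open import Algebra.Properties.Semiring.Mult.TCOptimised semiring
    using (×-homo-+; ×1-homo-*; 1+×) renaming (_×_ to _×ₙ_)
  open import Relation.Binary.Reasoning.Setoid setoid

  fromℤ : ℤ → Carrier
  fromℤ (+ n)    = n ×ₙ 1#
  fromℤ -[1+ n ] = - (suc n ×ₙ 1#)

  fromℤ-homo-neg : ∀ i → fromℤ (ℤ.- i) ≈ - fromℤ i
  fromℤ-homo-neg (+ zero)  = sym ε⁻¹≈ε
  fromℤ-homo-neg (+ suc n) = refl
  fromℤ-homo-neg -[1+ n ]  = sym (⁻¹-involutive _)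

  private
    fromℤ-⊖-+ : ∀ m n → fromℤ (m ℤ.⊖ n) + n ×ₙ 1# ≈ m ×ₙ 1#
    fromℤ-⊖-+ zero    zero    = +-identityˡ _
    fromℤ-⊖-+ (suc m) zero    = +-identityʳ _
    fromℤ-⊖-+ zero    (suc n) = -‿inverseˡ _
    fromℤ-⊖-+ (suc m) (suc n) rewrite ℤ.[1+m]⊖[1+n]≡m⊖n m n = begin
      fromℤ (m ℤ.⊖ n) + suc n ×ₙ 1#     ≈⟨ +-congˡ (1+× n 1#) ⟩
      fromℤ (m ℤ.⊖ n) + (1# + n ×ₙ 1#)  ≈⟨ +-assoc _ _ _ ⟨
      fromℤ (m ℤ.⊖ n) + 1# + n ×ₙ 1#    ≈⟨ +-congʳ (+-comm _ _) ⟩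
      1# + fromℤ (m ℤ.⊖ n) + n ×ₙ 1#    ≈⟨ +-assoc _ _ _ ⟩
      1# + (fromℤ (m ℤ.⊖ n) + n ×ₙ 1#)  ≈⟨ +-congˡ (fromℤ-⊖-+ m n) ⟩
      1# + m ×ₙ 1#                      ≈⟨ 1+× m 1# ⟨
      suc m ×ₙ 1#                       ∎

  fromℤ-⊖ : ∀ m n → fromℤ (m ℤ.⊖ n) ≈ m ×ₙ 1# - n ×ₙ 1#
  fromℤ-⊖ m n = begin
    fromℤ (m ℤ.⊖ n)                      ≈⟨ //-rightDividesʳ (n ×ₙ 1#) _ ⟨
    fromℤ (m ℤ.⊖ n) + n ×ₙ 1# - n ×ₙ 1#   ≈⟨ +-congʳ (fromℤ-⊖-+ m n) ⟩
    m ×ₙ 1# - n ×ₙ 1#                      ∎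

  fromℤ-homo-+ : ∀ i j → fromℤ (i ℤ.+ j) ≈ fromℤ i + fromℤ j
  fromℤ-homo-+ (+ m)    (+ n)    = ×-homo-+ 1# m n
  fromℤ-homo-+ (+ m)    -[1+ n ] = fromℤ-⊖ m (suc n)
  fromℤ-homo-+ -[1+ m ] (+ n)    = trans (fromℤ-⊖ n (suc m)) (+-comm _ _)
  fromℤ-homo-+ -[1+ m ] -[1+ n ] = begin
    - (suc (suc (m ℕ.+ n)) ×ₙ 1#)       ≡⟨ ≡.cong (λ k → - (suc k ×ₙ 1#)) (ℕ.+-suc m n) ⟨
    - ((suc m ℕ.+ suc n) ×ₙ 1#)         ≈⟨ -‿cong (×-homo-+ 1# (suc m) (suc n)) ⟩
    - (suc m ×ₙ 1# + suc n ×ₙ 1#)        ≈⟨ ⁻¹-∙-comm _ _ ⟨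
    - (suc m ×ₙ 1#) + - (suc n ×ₙ 1#)    ∎

  private
    fromℤ-homo-+* : ∀ m n → fromℤ (+ m ℤ.* + n) ≈ m ×ₙ 1# * n ×ₙ 1#
    fromℤ-homo-+* m n = begin
      fromℤ (+ m ℤ.* + n)  ≡⟨ ≡.cong fromℤ (ℤ.pos-* m n) ⟨
      (m ℕ.* n) ×ₙ 1#       ≈⟨ ×1-homo-* m n ⟩
      m ×ₙ 1# * n ×ₙ 1#      ∎

    fromℤ-homo-*-pos : ∀ m j → fromℤ (+ m ℤ.* j) ≈ m ×ₙ 1# * fromℤ j
    fromℤ-homo-*-pos m (+ n)    = fromℤ-homo-+* m n
    fromℤ-homo-*-pos m -[1+ n ] = begin
      fromℤ (+ m ℤ.* -[1+ n ])         ≡⟨ ≡.cong fromℤ (ℤ.neg-distribʳ-* (+ m) (+ suc n)) ⟨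
      fromℤ (ℤ.- (+ m ℤ.* + suc n))    ≈⟨ fromℤ-homo-neg (+ m ℤ.* + suc n) ⟩
      - fromℤ (+ m ℤ.* + suc n)        ≈⟨ -‿cong (fromℤ-homo-+* m (suc n)) ⟩
      - (m ×ₙ 1# * suc n ×ₙ 1#)          ≈⟨ -‿distribʳ-* _ _ ⟩
      m ×ₙ 1# * - (suc n ×ₙ 1#)          ∎

  fromℤ-homo-* : ∀ i j → fromℤ (i ℤ.* j) ≈ fromℤ i * fromℤ j
  fromℤ-homo-* (+ m)    j = fromℤ-homo-*-pos m j
  fromℤ-homo-* -[1+ m ] j = begin
    fromℤ (-[1+ m ] ℤ.* j)           ≡⟨ ≡.cong fromℤ (ℤ.neg-distribˡ-* (+ suc m) j) ⟨
    fromℤ (ℤ.- (+ suc m ℤ.* j))      ≈⟨ fromℤ-homo-neg (+ suc m ℤ.* j) ⟩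
    - fromℤ (+ suc m ℤ.* j)          ≈⟨ -‿cong (fromℤ-homo-*-pos (suc m) j) ⟩
    - (suc m ×ₙ 1# * fromℤ j)         ≈⟨ -‿distribˡ-* _ _ ⟩
    - (suc m ×ₙ 1#) * fromℤ j         ∎

  ℤ-rawRing : RawRing _ _
  ℤ-rawRing = record
    { Carrier = ℤ ; _≈_ = _≡_ ; _+_ = ℤ._+_ ; _*_ = ℤ._*_ ; -_ = ℤ.-_ ; 0# = ℤ.0ℤ ; 1# = ℤ.1ℤ }

  homomorphism : ℤ-rawRing -Raw-AlmostCommutative⟶ fromCommutativeRing R
  homomorphism = record
    { ⟦_⟧    = fromℤ
    ; +-homo = fromℤ-homo-+
    ; *-homo = fromℤ-homo-*
    ; -‿homo = fromℤ-homo-neg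
    ; 0-homo = refl
    ; 1-homo = refl
    }

  fromℤ-≡ : ∀ i j → Maybe (fromℤ i ≈ fromℤ j)
  fromℤ-≡ i j with i ℤ.≟ j
  ... | yes ≡.refl = just refl
  ... | no _       = nothing

  open import Algebra.Solver.Ring ℤ-rawRing (fromCommutativeRing R) homomorphism fromℤ-≡ public

module OrderedFieldProperties {c ℓ₁ ℓ₂} (F : OrderedField c ℓ₁ ℓ₂) where

  open OrderedField F

  commutativeRing : CommutativeRing c ℓ₁
  commutativeRing = record { isCommutativeRing = isCommutativeRing }

  open CommutativeRing commutativeRing
    using (refl; sym; trans; +-congˡ; +-congʳ; *-cong; +-identityˡ; +-identityʳ;
           -‿cong; -‿inverseʳ; zeroˡ; zeroʳ; ring; +-group; setoid)
  open IsStrictTotalOrder isStrictTotalOrder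
    using (irrefl; compare; <-respʳ-≈; <-respˡ-≈) renaming (trans to <-trans)
  open import Algebra.Properties.Ring ring using (-‿distribˡ-*; -‿distribʳ-*)
  open import Algebra.Properties.Group +-group using (⁻¹-involutive)
  open import Relation.Binary.Reasoning.Setoid setoid
  open IntegerCoefficients commutativeRing
    using (solve; _:=_; _:+_; _:*_; _:-_; con; Polynomial)

  ≤⇒≯ : ∀ {x y} → x ≤ y → ¬ (y < x)
  ≤⇒≯ (inj₁ x<y) y<x = irrefl refl (<-trans x<y y<x)
  ≤⇒≯ (inj₂ x≈y) y<x = irrefl (sym x≈y) y<x

  ≤∧≉⇒< : ∀ {x y} → x ≤ y → ¬ (x ≈ y) → x < y
  ≤∧≉⇒< (inj₁ x<y) _   = x<y
  ≤∧≉⇒< (inj₂ x≈y) x≉y = ⊥-elim (x≉y x≈y)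

  -x*-y≈x*y : ∀ x y → - x * - y ≈ x * y
  -x*-y≈x*y x y = begin
    - x * - y      ≈⟨ -‿distribˡ-* x (- y) ⟨
    - (x * - y)    ≈⟨ -‿cong (-‿distribʳ-* x y) ⟨
    - - (x * y)    ≈⟨ ⁻¹-involutive (x * y) ⟩
    x * y          ∎

  x<0⇒0<-x : ∀ {x} → x < 0# → 0# < - x
  x<0⇒0<-x {x} x<0 = <-respˡ-≈ (-‿inverseʳ x) (<-respʳ-≈ (+-identityˡ (- x)) (+-mono-< (- x) x<0))

  square-nonneg : ∀ s → 0# ≤ s * s
  square-nonneg s with compare 0# s
  ... | tri< 0<s _ _ = inj₁ (*-pos 0<s 0<s)
  ... | tri≈ _ 0≈s _ = inj₂ (sym (trans (*-cong (sym 0≈s) refl) (zeroˡ s)))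
  ... | tri> _ _ s<0 = inj₁ (<-respʳ-≈ (-x*-y≈x*y s s) (*-pos (x<0⇒0<-x s<0) (x<0⇒0<-x s<0)))

  product≉0 : ∀ {x y z} → z ≤ 1# → 1# < x * y + z → ¬ (x * y ≈ 0#)
  product≉0 {z = z} z≤1 1<xy+z xy≈0 =
    ≤⇒≯ z≤1 (<-respʳ-≈ (trans (+-congʳ xy≈0) (+-identityˡ z)) 1<xy+z)

  left≉0 : ∀ {x y z} → z ≤ 1# → 1# < x * y + z → ¬ (0# ≈ x)
  left≉0 {y = y} z≤1 1<xy+z 0≈x =
    product≉0 z≤1 1<xy+z (trans (*-cong (sym 0≈x) refl) (zeroˡ y))

  right≉0 : ∀ {x y z} → z ≤ 1# → 1# < x * y + z → ¬ (0# ≈ y)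
  right≉0 {x = x} z≤1 1<xy+z 0≈y =
    product≉0 z≤1 1<xy+z (trans (*-cong refl (sym 0≈y)) (zeroʳ x))

  InR⇒positive : ∀ α β γ → InR α β γ → 0# < α × 0# < β × 0# < γ
  InR⇒positive α β γ (((0≤α , _) , (0≤β , β≤1) , (0≤γ , γ≤1)) , αβ+γ>1 , αγ+β>1 , _) =
      ≤∧≉⇒< 0≤α (left≉0 γ≤1 αβ+γ>1)
    , ≤∧≉⇒< 0≤β (right≉0 γ≤1 αβ+γ>1)
    , ≤∧≉⇒< 0≤γ (right≉0 β≤1 αγ+β>1)

  -- ⟦ two ⟧ is definitionally 2#, and 4# is 2# + 2#, so the solver's final refl goes through.
  one two : ∀ {n} → Polynomial n
  one = con (+ 1)
  two = con (+ 2)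

  Δ-poly : ∀ {n} → Polynomial n → Polynomial n → Polynomial n → Polynomial n
  Δ-poly a b g = a :* a :+ b :* b :+ g :* g
               :- two :* a :* b :- two :* a :* g :- two :* b :* g
               :+ (two :+ two) :* a :* b :* g

  Δ-square-form : ∀ α β γ → Δ α β γ ≈ (β + γ - α) * (β + γ - α) + 4# * β * γ * (α - 1#)
  Δ-square-form = solve 3 (λ a b g → Δ-poly a b g
    := (b :+ g :- a) :* (b :+ g :- a) :+ (two :+ two) :* b :* g :* (a :- one)) refl

  Δ-swap₁₂ : ∀ α β γ → Δ α β γ ≈ Δ β α γ
  Δ-swap₁₂ = solve 3 (λ a b g → Δ-poly a b g := Δ-poly b a g) refl

  Δ-swap₁₃ : ∀ α β γ → Δ α β γ ≈ Δ γ β α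
  Δ-swap₁₃ = solve 3 (λ a b g → Δ-poly a b g := Δ-poly g b a) refl

  Δ<0⇒≉1 : ∀ {α β γ} → Δ α β γ < 0# → ¬ (α ≈ 1#)
  Δ<0⇒≉1 {α} {β} {γ} Δ<0 α≈1 = ≤⇒≯ (square-nonneg s) (<-respˡ-≈ Δ≈s² Δ<0)
    where
    s k : Carrier
    s = β + γ - α
    k = 4# * β * γ
    Δ≈s² : Δ α β γ ≈ s * s
    Δ≈s² = begin
      Δ α β γ                ≈⟨ Δ-square-form α β γ ⟩
      s * s + k * (α - 1#)   ≈⟨ +-congˡ (*-cong refl (+-congʳ α≈1)) ⟩
      s * s + k * (1# - 1#)  ≈⟨ +-congˡ (*-cong refl (-‿inverseʳ 1#)) ⟩
      s * s + k * 0#         ≈⟨ +-congˡ (zeroʳ k) ⟩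
      s * s + 0#             ≈⟨ +-identityʳ _ ⟩
      s * s                  ∎

  InR₂⇒<1 : ∀ α β γ → InR₂ α β γ → α < 1# × β < 1# × γ < 1#
  InR₂⇒<1 α β γ ((((_ , α≤1) , (_ , β≤1) , (_ , γ≤1)) , _) , Δ<0) =
      ≤∧≉⇒< α≤1 (Δ<0⇒≉1 Δ<0)
    , ≤∧≉⇒< β≤1 (Δ<0⇒≉1 (<-respˡ-≈ (Δ-swap₁₂ α β γ) Δ<0))
    , ≤∧≉⇒< γ≤1 (Δ<0⇒≉1 (<-respˡ-≈ (Δ-swap₁₃ α β γ) Δ<0))

lemma4 : ∀ {c ℓ₁ ℓ₂} (F : OrderedField c ℓ₁ ℓ₂) → let open OrderedField F in
           (∀ α β γ → InR α β γ → 0# < α × 0# < β × 0# < γ)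
           × (∀ α β γ → InR₂ α β γ →
                (0# < α × α < 1#) × (0# < β × β < 1#) × (0# < γ × γ < 1#))
lemma4 F = InR⇒positive , InR₂⇒bounds
  where
  open OrderedField F
  open OrderedFieldProperties F
  InR₂⇒bounds : ∀ α β γ → InR₂ α β γ →
                (0# < α × α < 1#) × (0# < β × β < 1#) × (0# < γ × γ < 1#)
  InR₂⇒bounds α β γ r₂@(r , _) with InR⇒positive α β γ r | InR₂⇒<1 α β γ r₂
  ... | 0<α , 0<β , 0<γ | α<1 , β<1 , γ<1 = (0<α , α<1) , (0<β , β<1) , (0<γ , γ<1)
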